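{- Fix a finite lattice $\Lambda$ with least element $\mathbb{0}$ and greatest element $\mathbb{1}$. Let $\mathcal{M}_\Lambda$ be the category of $\Lambda$-ultrametric spaces with isometries (distance-preserving maps) as morphisms. Let $\mathcal{EQ}_\Lambda$ be the category of structures consisting of a set equipped with a family $\{E_\lambda:\lambda\in\Lambda\}$ of not necessarily distinct equivalence relations such that (1) $\{E_\lambda\}$ forms a lattice under inclusion, (2) the map $\lambda\mapsto E_\lambda$ is meet-preserving (in particular order-preserving), and (3) $E_{\mathbb{0}}$ is equality and $E_{\mathbb{1}}$ is the trivial (total) relation, with embeddings as morphisms. Then the functors $m:\mathcal{EQ}_\Lambda\to\mathcal{M}_\Lambda$, keeping the universe and setting $d(x,y)=\bigwedge\{\lambda\in\Lambda: xE_\lambda y\}$, and $e:\mathcal{M}_\Lambda\to\mathcal{EQ}_\Lambda$, keeping the universe and setting $E_\lambda=\{(x,y):d(x,y)\le\lambda\}$, are well defined, mutually inverse isomorphisms of categories, and they preserve homogeneity.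
   Context: A $\Lambda$-ultrametric space is a set $X$ with $d:X\times X\to\Lambda$ such that $d(x,y)=\mathbb{0}$ iff $x=y$, $d(x,y)=d(y,x)$, and $d(x,z)\le d(x,y)\vee d(y,z)$; it is viewed as a relational structure with one binary relation for each distance. A structure is homogeneous if every isomorphism between finite substructures extends to an automorphism. -}

module Defs where

open import Level using (0ℓ)
open import Data.Nat using (ℕ)
open import Data.Fin using (Fin)
open import Data.List using (List; foldr; filter)
open import Data.List.Membership.Propositional using (_∈_)
open import Data.Product using (Σ; ∃; _×_)
open import Function.Bundles using (_⇔_; _↔_; Inverse)
open import Function.Definitions using (Injective)
open import Algebra.Core using (Op₂)
open import Axiom.ExcludedMiddle using (ExcludedMiddle)
open import Relation.Binary.Core using (Rel)
open import Relation.Binary.Structures using (IsEquivalence)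
open import Relation.Binary.PropositionalEquality using (_≡_)
import Relation.Binary.Lattice.Structures as LS

-- A finite (hence bounded) lattice Λ with least element ⊥ (= 𝟘) and
-- greatest element ⊤ (= 𝟙).  Equality is propositional equality;
-- finiteness is given by a list enumerating all elements.

record FiniteLattice : Set₁ where
  field
    Carrier          : Set
    _≤_              : Rel Carrier 0ℓ
    _∨_              : Op₂ Carrier
    _∧_              : Op₂ Carrier
    ⊤                : Carrier
    ⊥                : Carrier
    isBoundedLattice : LS.IsBoundedLattice _≡_ _≤_ _∨_ _∧_ ⊤ ⊥
    elements         : List Carrier
    complete         : ∀ x → x ∈ elements

  ⋀ : List Carrier → Carrier
  ⋀ = foldr _∧_ ⊤

record BinStructure (I : Set) : Set₁ where
  field
    U : Set
    R : I → U → U → Set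

module _ {I : Set} (S : BinStructure I) where
  open BinStructure S

  IsAutomorphism : U ↔ U → Set
  IsAutomorphism σ = ∀ k x y → R k x y ⇔ R k (Inverse.to σ x) (Inverse.to σ y)

  -- A finite substructure is the image of an injective a : Fin n → U;
  -- an isomorphism between finite substructures sends a i ↦ b i, where
  -- a, b are injective and a i, a j satisfy exactly the same relations
  -- as b i, b j.
  Homogeneous : Set
  Homogeneous =
    ∀ (n : ℕ) (a b : Fin n → U) →
    Injective _≡_ _≡_ a → Injective _≡_ _≡_ b →
    (∀ k i j → R k (a i) (a j) ⇔ R k (b i) (b j)) →
    Σ (U ↔ U) λ σ → IsAutomorphism σ × (∀ i → Inverse.to σ (a i) ≡ b i)

module _ (Λ : FiniteLattice) where
  open FiniteLattice Λ

  record RawUM : Set₁ where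
    field
      U : Set
      d : U → U → Carrier

  record RawEQ : Set₁ where
    field
      U  : Set
      E  : Carrier → U → U → Set

  record IsUltrametric (M : RawUM) : Set where
    open RawUM M
    field
      zero-iff : ∀ x y → (d x y ≡ ⊥) ⇔ (x ≡ y)
      symm     : ∀ x y → d x y ≡ d y x
      ultra    : ∀ x y z → d x z ≤ (d x y ∨ d y z)

  module _ (S : RawEQ) where
    open RawEQ S

    _⊆_ : (Rel U 0ℓ) → (Rel U 0ℓ) → Set
    P ⊆ Q = ∀ x y → P x y → Q x y

    IsGlbInFamily : Carrier → Carrier → Carrier → Set
    IsGlbInFamily ν l μ =
      (E ν ⊆ E l) × (E ν ⊆ E μ) ×
      (∀ κ → E κ ⊆ E l → E κ ⊆ E μ → E κ ⊆ E ν)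

    IsLubInFamily : Carrier → Carrier → Carrier → Set
    IsLubInFamily ν l μ =
      (E l ⊆ E ν) × (E μ ⊆ E ν) ×
      (∀ κ → E l ⊆ E κ → E μ ⊆ E κ → E ν ⊆ E κ)

    record IsEQStructure : Set where
      field
        equiv         : ∀ l → IsEquivalence (E l)
        family-meet   : ∀ l μ → ∃ λ ν → IsGlbInFamily ν l μ
        family-join   : ∀ l μ → ∃ λ ν → IsLubInFamily ν l μ
        meet-preserve : ∀ l μ x y → E (l ∧ μ) x y ⇔ (E l x y × E μ x y)
        bottom-eq     : ∀ x y → E ⊥ x y ⇔ (x ≡ y)
        top-total     : ∀ x y → E ⊤ x y

  IsIsometry : (M M' : RawUM) → (RawUM.U M → RawUM.U M') → Set
  IsIsometry M M' f = ∀ x y → RawUM.d M' (f x) (f y) ≡ RawUM.d M x y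

  IsEmbedding : (S S' : RawEQ) → (RawEQ.U S → RawEQ.U S') → Set
  IsEmbedding S S' f =
    Injective _≡_ _≡_ f ×
    (∀ l x y → RawEQ.E S l x y ⇔ RawEQ.E S' l (f x) (f y))

  -- the functor m (on objects; on morphisms it is the identity on maps):
  -- d(x,y) = ⋀ { λ : x E_λ y }
  -- (classical: the subset {λ : x E_λ y} of the finite Λ is formed
  -- using excluded middle)
  m : ExcludedMiddle 0ℓ → RawEQ → RawUM
  m em S = record { U = RawEQ.U S
                  ; d = λ x y → ⋀ (filter (λ l → em {RawEQ.E S l x y}) elements) }

  -- the functor e (on objects; on morphisms it is the identity on maps):
  -- E_λ = { (x,y) : d(x,y) ≤ λ }
  e : RawUM → RawEQ
  e M = record { U = RawUM.U M
               ; E = λ l x y → RawUM.d M x y ≤ l }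

  umStructure : RawUM → BinStructure Carrier
  umStructure M = record { U = RawUM.U M ; R = λ l x y → RawUM.d M x y ≡ l }

  eqStructure : RawEQ → BinStructure Carrier
  eqStructure S = record { U = RawEQ.U S ; R = RawEQ.E S }

module Submission where

-- Everything rests on one order-theoretic fact about the finite lattice Λ:
-- for a predicate P on Λ, write ⋀P for the meet of all λ with P λ.  If P
-- is a filter (upward closed, contains ⊤, closed under ∧), then P is the
-- principal filter of ⋀P, i.e.  ⋀P ≤ λ ⇔ P λ.  In an EQ_Λ structure the
-- predicate λ ↦ x E_λ y is such a filter, so the distance d = ⋀{λ : x E_λ y}
-- of m(S) satisfies the Galois correspondence  d(x,y) ≤ λ ⇔ x E_λ y,
-- which is literally the statement e(m(S)) = S.  Under this correspondence
-- the equivalence-relation axioms of E become the ultrametric axioms of d;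
-- conversely the ultrametric axioms make e(M) an EQ_Λ structure, where
-- joins in the family {E_λ} are obtained as ⋀ of the upper bounds.
-- For homogeneity we prove once, for arbitrary relational structures on a
-- common set, that homogeneity transfers along relation families which
-- determine each other on pairs; the relations "d = k" and "d ≤ λ" (hence
-- also E_λ) all determine the value d(x,y) and thus each other.

open import Defs
open import Level using (0ℓ)
open import Axiom.ExcludedMiddle using (ExcludedMiddle)
open import Data.Product using (Σ; _×_; _,_; proj₁; proj₂)
open import Data.List using (List; []; _∷_; filter)
open import Data.List.Membership.Propositional using (_∈_)
open import Data.List.Membership.Propositional.Properties using (∈-filter⁺; ∈-filter⁻)
open import Data.List.Relation.Unary.Any using (here; there)
open import Function.Bundles using (_⇔_; mk⇔; Equivalence; Inverse)
open import Function.Construct.Composition using (_⇔-∘_)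
open import Function.Construct.Symmetry using (⇔-sym)
open import Relation.Binary.PropositionalEquality using (_≡_; refl; sym; trans; subst)
open import Relation.Binary.Structures using (IsEquivalence)
import Relation.Binary.Lattice.Structures as LS

open Equivalence using (to; from)

SameType : {I U : Set} → (I → U → U → Set) → U → U → U → U → Set
SameType R x y x' y' = ∀ k → R k x y ⇔ R k x' y'

Determines : {I J U : Set} → (I → U → U → Set) → (J → U → U → Set) → Set
Determines R R' = ∀ x y x' y' → SameType R x y x' y' → SameType R' x y x' y'

determines-trans : {I J K U : Set} {R : I → U → U → Set} {R' : J → U → U → Set}
  {R'' : K → U → U → Set} → Determines R R' → Determines R' R'' → Determines R R''
determines-trans R⇒R' R'⇒R'' x y x' y' same = R'⇒R'' x y x' y' (R⇒R' x y x' y' same)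

determines-pointwise : {I U : Set} {R R' : I → U → U → Set} →
  (∀ k x y → R k x y ⇔ R' k x y) → Determines R R'
determines-pointwise R⇔R' x y x' y' same k =
  R⇔R' k x' y' ⇔-∘ (same k ⇔-∘ ⇔-sym (R⇔R' k x y))

-- Homogeneity transfers between interdefinable relation families on the
-- same set: partial isomorphisms and automorphisms are described by pair
-- types, which correspond to each other.
homogeneous-transfer : {I J U : Set} (R : I → U → U → Set) (R' : J → U → U → Set) →
  Determines R R' → Determines R' R →
  Homogeneous (record { U = U ; R = R }) → Homogeneous (record { U = U ; R = R' })
homogeneous-transfer R R' R⇒R' R'⇒R homogeneous n a b a-inj b-inj a≅b =
  let (σ , σ-auto , σ-extends) = homogeneous n a b a-inj b-inj
        (λ k i j → R'⇒R (a i) (a j) (b i) (b j) (λ k' → a≅b k' i j) k)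
      σx = Inverse.to σ
  in σ , (λ k x y → R⇒R' x y (σx x) (σx y) (λ k' → σ-auto k' x y) k) , σ-extends

module Correspondence (em : ExcludedMiddle 0ℓ) (Λ : FiniteLattice) where
  open FiniteLattice Λ
  open LS.IsBoundedLattice isBoundedLattice
    using (antisym; x∧y≤x; x∧y≤y; ∧-greatest; x≤x∨y; y≤x∨y; ∨-least; maximum; minimum)
    renaming (refl to ≤-refl; trans to ≤-trans)

  ⋀-lowerBound : ∀ {l} (xs : List Carrier) → l ∈ xs → ⋀ xs ≤ l
  ⋀-lowerBound (x ∷ xs) (here refl) = x∧y≤x x (⋀ xs)
  ⋀-lowerBound (x ∷ xs) (there l∈xs) = ≤-trans (x∧y≤y x (⋀ xs)) (⋀-lowerBound xs l∈xs)

  ⋀-greatest : ∀ {c} (xs : List Carrier) → (∀ l → l ∈ xs → c ≤ l) → c ≤ ⋀ xs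
  ⋀-greatest [] _ = maximum _
  ⋀-greatest (x ∷ xs) below = ∧-greatest (below x (here refl)) (⋀-greatest xs (λ l l∈xs → below l (there l∈xs)))

  meetOf : (Carrier → Set) → Carrier
  meetOf P = ⋀ (filter (λ l → em {P l}) elements)

  meetOf-lowerBound : (P : Carrier → Set) → ∀ l → P l → meetOf P ≤ l
  meetOf-lowerBound P l p = ⋀-lowerBound _ (∈-filter⁺ (λ l → em {P l}) (complete l) p)

  meetOf-greatest : (P : Carrier → Set) → ∀ c → (∀ l → P l → c ≤ l) → c ≤ meetOf P
  meetOf-greatest P c below =
    ⋀-greatest _ (λ l l∈ → below l (proj₂ (∈-filter⁻ (λ l → em {P l}) {xs = elements} l∈)))

  meetOf-antitone : (P Q : Carrier → Set) → (∀ l → Q l → P l) → meetOf P ≤ meetOf Q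
  meetOf-antitone P Q Q⊆P = meetOf-greatest Q (meetOf P) (λ l q → meetOf-lowerBound P l (Q⊆P l q))

  meetOf-cong : (P Q : Carrier → Set) → (∀ l → P l ⇔ Q l) → meetOf P ≡ meetOf Q
  meetOf-cong P Q P⇔Q = antisym (meetOf-antitone P Q (λ l → from (P⇔Q l)))
                                (meetOf-antitone Q P (λ l → to (P⇔Q l)))

  meetOf-principal : ∀ c → meetOf (c ≤_) ≡ c
  meetOf-principal c = antisym (meetOf-lowerBound (c ≤_) c ≤-refl) (meetOf-greatest (c ≤_) c (λ _ c≤l → c≤l))

  record IsFilter (P : Carrier → Set) : Set where
    field
      upward : ∀ {l μ} → l ≤ μ → P l → P μ
      top    : P ⊤
      meet   : ∀ {l μ} → P l → P μ → P (l ∧ μ)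

  filter-principal : {P : Carrier → Set} → IsFilter P → ∀ l → (meetOf P ≤ l) ⇔ P l
  filter-principal {P} isFilter l = mk⇔ (λ le → upward le (holds-of-⋀ _ onlyP)) (meetOf-lowerBound P l)
    where
      open IsFilter isFilter
      holds-of-⋀ : ∀ (xs : List Carrier) → (∀ μ → μ ∈ xs → P μ) → P (⋀ xs)
      holds-of-⋀ [] _ = top
      holds-of-⋀ (x ∷ xs) allP = meet (allP x (here refl)) (holds-of-⋀ xs (λ μ μ∈ → allP μ (there μ∈)))
      onlyP : ∀ μ → μ ∈ filter (λ l → em {P l}) elements → P μ
      onlyP μ μ∈ = proj₂ (∈-filter⁻ (λ l → em {P l}) {xs = elements} μ∈)

  ≡-type : ∀ {c c' : Carrier} → (∀ k → (c ≡ k) ⇔ (c' ≡ k)) → c ≡ c'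
  ≡-type same = sym (to (same _) refl)

  ≤-type : ∀ {c c' : Carrier} → (∀ l → (c ≤ l) ⇔ (c' ≤ l)) → c ≡ c'
  ≤-type same = antisym (from (same _) ≤-refl) (to (same _) ≤-refl)

  value-type : ∀ {c c' : Carrier} (R : Carrier → Carrier → Set) → c ≡ c' → ∀ k → R c k ⇔ R c' k
  value-type R refl k = mk⇔ (λ r → r) (λ r → r)

  ≡⊥⇔≤⊥ : ∀ {c : Carrier} → (c ≡ ⊥) ⇔ (c ≤ ⊥)
  ≡⊥⇔≤⊥ = mk⇔ (λ c≡⊥ → subst (_≤ ⊥) (sym c≡⊥) ≤-refl) (λ c≤⊥ → antisym c≤⊥ (minimum _))

  module _ {U : Set} (d : U → U → Carrier) where
    distance-determines-balls : Determines (λ k x y → d x y ≡ k) (λ l x y → d x y ≤ l)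
    distance-determines-balls x y x' y' same = value-type _≤_ (≡-type same)

    balls-determine-distance : Determines (λ l x y → d x y ≤ l) (λ k x y → d x y ≡ k)
    balls-determine-distance x y x' y' same = value-type _≡_ (≤-type same)

  module FromEQ (S : RawEQ Λ) (isEQ : IsEQStructure Λ S) where
    open RawEQ S
    open IsEQStructure isEQ

    dist : U → U → Carrier
    dist = RawUM.d (m Λ em S)

    E-monotone : ∀ {l μ x y} → l ≤ μ → E l x y → E μ x y
    E-monotone {l} {μ} l≤μ p = proj₂ (to (meet-preserve l μ _ _) (subst (λ ν → E ν _ _) (sym l∧μ≡l) p))
      where l∧μ≡l : l ∧ μ ≡ l
            l∧μ≡l = antisym (x∧y≤x l μ) (∧-greatest ≤-refl l≤μ)

    E-filter : ∀ x y → IsFilter (λ l → E l x y)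
    E-filter x y = record
      { upward = E-monotone
      ; top    = top-total x y
      ; meet   = λ p q → from (meet-preserve _ _ x y) (p , q) }

    dist≤⇔E : ∀ l x y → (dist x y ≤ l) ⇔ E l x y
    dist≤⇔E l x y = filter-principal (E-filter x y) l

    E-dist : ∀ x y → E (dist x y) x y
    E-dist x y = to (dist≤⇔E (dist x y) x y) ≤-refl

    isUltrametric : IsUltrametric Λ (m Λ em S)
    isUltrametric = record
      { zero-iff = λ x y → bottom-eq x y ⇔-∘ (dist≤⇔E ⊥ x y ⇔-∘ ≡⊥⇔≤⊥)
      ; symm     = λ x y → meetOf-cong _ _ (λ l → mk⇔ (IsEquivalence.sym (equiv l)) (IsEquivalence.sym (equiv l)))
      ; ultra    = λ x y z → from (dist≤⇔E _ x z)
          (IsEquivalence.trans (equiv _) (E-monotone (x≤x∨y _ _) (E-dist x y)) (E-monotone (y≤x∨y _ _) (E-dist y z)))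
      }

    e∘m≡id : ∀ l x y → RawEQ.E (e Λ (m Λ em S)) l x y ⇔ E l x y
    e∘m≡id = dist≤⇔E

    m-homogeneous : Homogeneous (eqStructure Λ S) → Homogeneous (umStructure Λ (m Λ em S))
    m-homogeneous = homogeneous-transfer E (λ k x y → dist x y ≡ k)
      (determines-trans (determines-pointwise (λ l x y → ⇔-sym (dist≤⇔E l x y))) (balls-determine-distance dist))
      (determines-trans (distance-determines-balls dist) (determines-pointwise dist≤⇔E))

  module FromUM (M : RawUM Λ) (isUM : IsUltrametric Λ M) where
    open RawUM M
    open IsUltrametric isUM

    BallInclusion : Carrier → Carrier → Set
    BallInclusion l κ = ∀ x y → d x y ≤ l → d x y ≤ κ

    -- The join of E_l and E_μ in the family is E_ν, where ν is the meet of
    -- all radii whose balls contain both (ν need not be l ∨ μ).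
    family-join : ∀ l μ → Σ Carrier (λ ν → IsLubInFamily Λ (e Λ M) ν l μ)
    family-join l μ =
      ν , (λ x y d≤l → meetOf-greatest Bounds _ (λ κ bound → proj₁ bound x y d≤l))
        , (λ x y d≤μ → meetOf-greatest Bounds _ (λ κ bound → proj₂ bound x y d≤μ))
        , (λ κ l⊆κ μ⊆κ x y d≤ν → ≤-trans d≤ν (meetOf-lowerBound Bounds κ (l⊆κ , μ⊆κ)))
      where
        Bounds : Carrier → Set
        Bounds κ = BallInclusion l κ × BallInclusion μ κ
        ν : Carrier
        ν = meetOf Bounds

    isEQStructure : IsEQStructure Λ (e Λ M)
    isEQStructure = record
      { equiv = λ l → record
          { refl  = λ {x} → subst (_≤ l) (sym (from (zero-iff x x) refl)) (minimum l)
          ; sym   = λ {x} {y} → subst (_≤ l) (symm x y)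
          ; trans = λ {x} {y} {z} d≤l d'≤l → ≤-trans (ultra x y z) (∨-least d≤l d'≤l) }
      ; family-meet = λ l μ → l ∧ μ
          , (λ x y d≤l∧μ → ≤-trans d≤l∧μ (x∧y≤x l μ))
          , (λ x y d≤l∧μ → ≤-trans d≤l∧μ (x∧y≤y l μ))
          , (λ κ κ⊆l κ⊆μ x y d≤κ → ∧-greatest (κ⊆l x y d≤κ) (κ⊆μ x y d≤κ))
      ; family-join = family-join
      ; meet-preserve = λ l μ x y →
          mk⇔ (λ d≤l∧μ → ≤-trans d≤l∧μ (x∧y≤x l μ) , ≤-trans d≤l∧μ (x∧y≤y l μ))
              (λ (d≤l , d≤μ) → ∧-greatest d≤l d≤μ)
      ; bottom-eq = λ x y → zero-iff x y ⇔-∘ ⇔-sym ≡⊥⇔≤⊥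
      ; top-total = λ x y → maximum _
      }

  m∘e≡id : ∀ (M : RawUM Λ) x y → RawUM.d (m Λ em (e Λ M)) x y ≡ RawUM.d M x y
  m∘e≡id M x y = meetOf-principal (RawUM.d M x y)

  m-isometry : ∀ (S S' : RawEQ Λ) (f : RawEQ.U S → RawEQ.U S') →
    IsEmbedding Λ S S' f → IsIsometry Λ (m Λ em S) (m Λ em S') f
  m-isometry S S' f (_ , f-preserves) x y = meetOf-cong _ _ (λ l → ⇔-sym (f-preserves l x y))

  e-embedding : ∀ (M M' : RawUM Λ) → IsUltrametric Λ M → IsUltrametric Λ M' →
    (f : RawUM.U M → RawUM.U M') → IsIsometry Λ M M' f → IsEmbedding Λ (e Λ M) (e Λ M') f
  e-embedding M M' isUM isUM' f isometry = injective , λ l x y → value-type _≤_ (sym (isometry x y)) l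
    where
      injective : ∀ {x y} → f x ≡ f y → x ≡ y
      injective {x} {y} fx≡fy = to (IsUltrametric.zero-iff isUM x y)
        (trans (sym (isometry x y)) (from (IsUltrametric.zero-iff isUM' (f x) (f y)) fx≡fy))

  e-homogeneous : ∀ (M : RawUM Λ) → Homogeneous (umStructure Λ M) → Homogeneous (eqStructure Λ (e Λ M))
  e-homogeneous M = homogeneous-transfer _ _ (distance-determines-balls (RawUM.d M)) (balls-determine-distance (RawUM.d M))

mainTheorem7 : (em : ExcludedMiddle 0ℓ) → (Λ : FiniteLattice) →
    (∀ (S : RawEQ Λ) → IsEQStructure Λ S → IsUltrametric Λ (m Λ em S)) ×
    (∀ (M : RawUM Λ) → IsUltrametric Λ M → IsEQStructure Λ (e Λ M)) ×
    (∀ (S S' : RawEQ Λ) → IsEQStructure Λ S → IsEQStructure Λ S' →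
       (f : RawEQ.U S → RawEQ.U S') →
       IsEmbedding Λ S S' f → IsIsometry Λ (m Λ em S) (m Λ em S') f) ×
    (∀ (M M' : RawUM Λ) → IsUltrametric Λ M → IsUltrametric Λ M' →
       (f : RawUM.U M → RawUM.U M') →
       IsIsometry Λ M M' f → IsEmbedding Λ (e Λ M) (e Λ M') f) ×
    (∀ (M : RawUM Λ) → IsUltrametric Λ M →
       ∀ x y → RawUM.d (m Λ em (e Λ M)) x y ≡ RawUM.d M x y) ×
    (∀ (S : RawEQ Λ) → IsEQStructure Λ S →
       ∀ l x y → RawEQ.E (e Λ (m Λ em S)) l x y ⇔ RawEQ.E S l x y) ×
    (∀ (S : RawEQ Λ) → IsEQStructure Λ S →
       Homogeneous (eqStructure Λ S) → Homogeneous (umStructure Λ (m Λ em S))) ×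
    (∀ (M : RawUM Λ) → IsUltrametric Λ M →
       Homogeneous (umStructure Λ M) → Homogeneous (eqStructure Λ (e Λ M)))
mainTheorem7 em Λ =
    FromEQ.isUltrametric
  , FromUM.isEQStructure
  , (λ S S' _ _ → m-isometry S S')
  , e-embedding
  , (λ M _ → m∘e≡id M)
  , FromEQ.e∘m≡id
  , FromEQ.m-homogeneous
  , (λ M _ → e-homogeneous M)
  where open Correspondence em Λ
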